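{- Let $V\in M_{r\times t}(\mathbb{Z})$ have rank $r$ and finite complexity, and let $i\ne j$ be two indices in $[t]$. Then for every positive integer $N$, $$\#\{y\in([-N,N]\cap\mathbb{Z})^t : Vy=0 \text{ and } y_i=y_j\}\ll_V N^{t-r-1}.$$
   Context: For a system of linear forms $\psi=(\psi_1,\dots,\psi_t)$ over $\mathbb{Q}$ and $i\in[t]$, the complexity at $i$ is the least $s\ge0$ such that $[t]\setminus\{i\}$ can be partitioned into $s+1$ non-empty sets $X_1,\dots,X_{s+1}$ with $\psi_i\notin\langle\psi_j:j\in X_k\rangle$ for all $k$ ($\infty$ if none exists); the complexity of $\psi$ is the maximum over $i$, and the complexity of $V$ is that of any linear surjection $\psi:\mathbb{Q}^d\twoheadrightarrow\ker_{\mathbb{Q}}(V)$. Finite complexity is equivalent to no two distinct forms $\psi_i,\psi_j$ ($i\neq j$) being linearly dependent. -}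

module Defs where

open import Data.Nat as ℕ using (ℕ; zero; suc)
open import Data.Integer as ℤ using (ℤ)
open import Data.Rational as ℚ using (ℚ; 0ℚ)
open import Data.Fin using (Fin; zero; suc)
open import Data.Fin.Properties using (all?)
open import Data.Vec using (Vec; []; _∷_; lookup)
open import Data.List using (List; []; _∷_; map; concatMap; upTo; filter; length)
open import Data.Product using (Σ; ∃; _×_; _,_)
open import Relation.Binary.PropositionalEquality using (_≡_; _≢_)
open import Relation.Nullary using (¬_; Dec)
open import Relation.Nullary.Decidable using (_×-dec_)

Matℤ : ℕ → ℕ → Set
Matℤ r t = Fin r → Fin t → ℤ

toℚ : ℤ → ℚ
toℚ z = z ℚ./ 1

Σℚ : (n : ℕ) → (Fin n → ℚ) → ℚ
Σℚ zero    f = 0ℚ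
Σℚ (suc n) f = f zero ℚ.+ Σℚ n (λ k → f (suc k))

Σℤ : (n : ℕ) → (Fin n → ℤ) → ℤ
Σℤ zero    f = ℤ.0ℤ
Σℤ (suc n) f = f zero ℤ.+ Σℤ n (λ k → f (suc k))

HasRankRows : ∀ {r t} → Matℤ r t → Set
HasRankRows {r} {t} V =
  (c : Fin r → ℚ) →
    (∀ l → Σℚ r (λ k → c k ℚ.* toℚ (V k l)) ≡ 0ℚ) → ∀ k → c k ≡ 0ℚ

-- ψ = (ψ_1,…,ψ_t) : ℚ^d → ℚ^t, ψ_j a linear form on ℚ^d given by its
-- coefficient vector ψ j : Fin d → ℚ.
apply : ∀ {t d} → (Fin t → Fin d → ℚ) → (Fin d → ℚ) → Fin t → ℚ
apply {t} {d} ψ u j = Σℚ d (λ l → ψ j l ℚ.* u l)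

InKer : ∀ {r t} → Matℤ r t → (Fin t → ℚ) → Set
InKer {r} {t} V x = ∀ k → Σℚ t (λ j → toℚ (V k j) ℚ.* x j) ≡ 0ℚ

IsParametrisation : ∀ {r t d} → Matℤ r t → (Fin t → Fin d → ℚ) → Set
IsParametrisation {d = d} V ψ =
  (∀ (u : Fin d → ℚ) → InKer V (apply ψ u)) ×
  (∀ x → InKer V x → ∃ λ (u : Fin d → ℚ) → ∀ j → apply ψ u j ≡ x j)

InSpan : ∀ {t d} → (Fin t → Fin d → ℚ) → (Fin t → Set) → (Fin d → ℚ) → Set
InSpan {t} {d} ψ X v =
  ∃ λ (c : Fin t → ℚ) → (∀ j → ¬ X j → c j ≡ 0ℚ) ×
     (∀ l → Σℚ t (λ j → c j ℚ.* ψ j l) ≡ v l)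

-- A partition of [t] ∖ {i} into s+1 non-empty sets X_1,…,X_{s+1}
-- (given by the block assignment a) such that ψ_i ∉ ⟨ψ_j : j ∈ X_k⟩ ∀ k.
GoodPartition : ∀ {t d} → (Fin t → Fin d → ℚ) → Fin t → (s : ℕ) → Set
GoodPartition {t} ψ i s =
  Σ ((j : Fin t) → j ≢ i → Fin (suc s)) λ a →
    (∀ k → ∃ λ j → Σ (j ≢ i) λ p → a j p ≡ k) ×
    (∀ k → ¬ InSpan ψ (λ j → Σ (j ≢ i) λ p → a j p ≡ k) (ψ i))

FiniteComplexityAt : ∀ {t d} → (Fin t → Fin d → ℚ) → Fin t → Set
FiniteComplexityAt ψ i = ∃ λ s → GoodPartition ψ i s

FiniteComplexityForms : ∀ {t d} → (Fin t → Fin d → ℚ) → Set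
FiniteComplexityForms {t} ψ = ∀ (i : Fin t) → FiniteComplexityAt ψ i

-- V has finite complexity: the complexity of a linear surjection
-- ψ : ℚ^d ↠ ker_ℚ(V) is finite (independent of the choice of ψ).
FiniteComplexity : ∀ {r t} → Matℤ r t → Set
FiniteComplexity {r} {t} V =
  ∃ λ d → Σ (Fin t → Fin d → ℚ) λ ψ →
    IsParametrisation V ψ × FiniteComplexityForms ψ

range : ℕ → List ℤ
range N = map (λ k → ℤ.+ k ℤ.- ℤ.+ N) (upTo (suc (2 ℕ.* N)))

-- ([-N, N] ∩ ℤ)^t, each vector listed exactly once
box : ℕ → (t : ℕ) → List (Vec ℤ t)
box N zero    = [] ∷ []
box N (suc t) = concatMap (λ a → map (a ∷_) (box N t)) (range N)

Pred : ∀ {r t} → Matℤ r t → Fin t → Fin t → Vec ℤ t → Set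
Pred {r} {t} V i j y =
  (∀ k → Σℤ t (λ l → V k l ℤ.* lookup y l) ≡ ℤ.0ℤ) × (lookup y i ≡ lookup y j)

Pred? : ∀ {r t} (V : Matℤ r t) i j (y : Vec ℤ t) → Dec (Pred V i j y)
Pred? {r} {t} V i j y =
  all? (λ k → Σℤ t (λ l → V k l ℤ.* lookup y l) ℤ.≟ ℤ.0ℤ)
  ×-dec (lookup y i ℤ.≟ lookup y j)

count : ∀ {r t} → Matℤ r t → Fin t → Fin t → ℕ → ℕ
count {r} {t} V i j N = length (filter (Pred? V i j) (box N t))

module Submission where

-- Adjoining the row e_i − e_j to V keeps the r + 1 rows linearly independent over ℚ: a
-- dependency involving it would force x_i = x_j on ker V, hence ψ_i = ψ_j for a
-- parametrisation ψ of ker V, and then ψ_i would lie in the span of the block containing j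
-- of any partition at i. Integer points of [−N, N]^t satisfying m independent equations are
-- counted by Gaussian elimination on the first coordinate: if the first column vanishes that
-- coordinate is free (2N + 1 choices), otherwise a pivot row determines it from the others
-- at the cost of one equation. This gives (2N + 1)^(t − r − 1) ≤ 3^(t − r − 1) N^(t − r − 1).

open import Defs
open import Data.Fin as Fin using (Fin; zero; suc; punchIn)
open import Data.Nat using (ℕ; zero; suc; _≤_; z≤n; s≤s)
import Data.Nat.Properties as ℕ
open import Data.Product using (Σ; ∃; _,_)
open import Data.Vec.Functional using (Vector; tail)
open import Function using (_∘_)
open import Relation.Binary.PropositionalEquality
open import Relation.Nullary using (¬_; yes; no; contradiction)
open import Relation.Unary using (Decidable)

private
  variable
    m n : ℕ

module LinearSystems where

  open import Data.Fin.Properties using (all?; ¬∀⟶∃¬; punchInᵢ≢i)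
  open import Data.Integer as ℤ using (ℤ; -[1+_])
  import Data.Integer.Properties as ℤ
  import Data.Nat.Coprimality as Coprime
  open import Data.Rational as ℚ using (ℚ; mkℚ; 0ℚ; 1ℚ; _+_; _*_; -_; 1/_)
  import Data.Rational.Properties as ℚ
  open import Data.Rational.Solver using (module +-*-Solver)
  open import Data.Vec.Functional using (insertAt)
  open import Data.Vec.Functional.Properties using (insertAt-lookup; insertAt-punchIn)
  open import Algebra.Bundles using (CommutativeRing)
  open import Algebra.Properties.Group ℚ.+-0-group using (∙-cancelʳ)
  open import Algebra.Properties.Semiring.Sum (CommutativeRing.semiring ℚ.+-*-commutativeRing)
    using ( sum-syntax; sum-cong-≗; sum-replicate-zero; sum-remove; ∑-distrib-+; ∑-comm
          ; *-distribˡ-sum; *-distribʳ-sum)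
  open +-*-Solver using (solve; _:+_; _:*_; _:=_; :-_)

  Σℚ≡∑ : ∀ n (f : Fin n → ℚ) → Σℚ n f ≡ ∑[ k < n ] f k
  Σℚ≡∑ zero    f = refl
  Σℚ≡∑ (suc n) f = cong (f zero +_) (Σℚ≡∑ n (f ∘ suc))

  *-cancelˡ-≢0 : ∀ p {q r} → p ≢ 0ℚ → p * q ≡ p * r → q ≡ r
  *-cancelˡ-≢0 p {q} {r} p≢0 pq≡pr = begin
    q                ≡⟨ sym (ℚ.*-identityˡ q) ⟩
    1ℚ * q           ≡⟨ cong (_* q) (sym (ℚ.*-inverseˡ p)) ⟩
    1/ p * p * q     ≡⟨ ℚ.*-assoc (1/ p) p q ⟩
    1/ p * (p * q)   ≡⟨ cong (1/ p *_) pq≡pr ⟩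
    1/ p * (p * r)   ≡⟨ sym (ℚ.*-assoc (1/ p) p r) ⟩
    1/ p * p * r     ≡⟨ cong (_* r) (ℚ.*-inverseˡ p) ⟩
    1ℚ * r           ≡⟨ ℚ.*-identityˡ r ⟩
    r                ∎
    where
    open ≡-Reasoning
    instance _ = ℚ.≢-nonZero p≢0

  δ : Fin n → Fin n → ℚ
  δ j l with j Fin.≟ l
  ... | yes _ = 1ℚ
  ... | no  _ = 0ℚ

  δ-diagonal : (j : Fin n) → δ j j ≡ 1ℚ
  δ-diagonal j with j Fin.≟ j
  ... | yes _   = refl
  ... | no  j≢j = contradiction refl j≢j

  δ-offDiagonal : {j l : Fin n} → j ≢ l → δ j l ≡ 0ℚ
  δ-offDiagonal {j = j} {l} j≢l with j Fin.≟ l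
  ... | yes j≡l = contradiction j≡l j≢l
  ... | no  _   = refl

  ∑-zero : {f : Vector ℚ m} → (∀ k → f k ≡ 0ℚ) → ∑[ k < m ] f k ≡ 0ℚ
  ∑-zero {m} f≗0 = trans (sum-cong-≗ f≗0) (sum-replicate-zero m)

  ∑-δ : (j : Fin n) (f : Vector ℚ n) → ∑[ l < n ] (δ j l * f l) ≡ f j
  ∑-δ {suc n} j f = begin
    ∑[ l < suc n ] (δ j l * f l)
      ≡⟨ sum-remove {i = j} (λ l → δ j l * f l) ⟩
    δ j j * f j + ∑[ k < n ] (δ j (punchIn j k) * f (punchIn j k))
      ≡⟨ cong₂ _+_ (cong (_* f j) (δ-diagonal j)) (∑-zero off-diagonal) ⟩
    1ℚ * f j + 0ℚ
      ≡⟨ ℚ.+-identityʳ (1ℚ * f j) ⟩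
    1ℚ * f j
      ≡⟨ ℚ.*-identityˡ (f j) ⟩
    f j ∎
    where
    open ≡-Reasoning
    off-diagonal : ∀ k → δ j (punchIn j k) * f (punchIn j k) ≡ 0ℚ
    off-diagonal k = trans (cong (_* f (punchIn j k)) (δ-offDiagonal (punchInᵢ≢i j k ∘ sym)))
                           (ℚ.*-zeroˡ (f (punchIn j k)))

  infix 7 _∙_
  _∙_ : Vector ℚ n → Vector ℚ n → ℚ
  _∙_ {n} f x = ∑[ l < n ] (f l * x l)

  ∙-linearˡ : (f g x : Vector ℚ n) (c : ℚ) → (λ l → f l + c * g l) ∙ x ≡ f ∙ x + c * (g ∙ x)
  ∙-linearˡ {n} f g x c = begin
    ∑[ l < n ] ((f l + c * g l) * x l)
      ≡⟨ sum-cong-≗ (λ l → solve 4 (λ f g c x → (f :+ c :* g) :* x := f :* x :+ c :* (g :* x))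
                                    refl (f l) (g l) c (x l)) ⟩
    ∑[ l < n ] (f l * x l + c * (g l * x l))
      ≡⟨ ∑-distrib-+ (λ l → f l * x l) (λ l → c * (g l * x l)) ⟩
    f ∙ x + ∑[ l < n ] (c * (g l * x l))
      ≡⟨ cong (f ∙ x +_) (sym (*-distribˡ-sum c (λ l → g l * x l))) ⟩
    f ∙ x + c * (g ∙ x) ∎
    where open ≡-Reasoning

  ∑-∙ : (c : Vector ℚ m) (F : Fin m → Vector ℚ n) (x : Vector ℚ n) →
        ∑[ k < m ] (c k * (F k ∙ x)) ≡ (λ l → ∑[ k < m ] (c k * F k l)) ∙ x
  ∑-∙ {m} {n} c F x = begin
    ∑[ k < m ] (c k * (F k ∙ x))
      ≡⟨ sum-cong-≗ (λ k → *-distribˡ-sum (c k) (λ l → F k l * x l)) ⟩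
    ∑[ k < m ] ∑[ l < n ] (c k * (F k l * x l))
      ≡⟨ ∑-comm (λ k l → c k * (F k l * x l)) ⟩
    ∑[ l < n ] ∑[ k < m ] (c k * (F k l * x l))
      ≡⟨ sum-cong-≗ (λ l → trans (sum-cong-≗ (λ k → sym (ℚ.*-assoc (c k) (F k l) (x l))))
                                 (sym (*-distribʳ-sum (x l) (λ k → c k * F k l)))) ⟩
    (λ l → ∑[ k < m ] (c k * F k l)) ∙ x ∎
    where open ≡-Reasoning

  ∙-head-tail : (f x : Vector ℚ (suc n)) → f ∙ x ≡ f zero * x zero + tail f ∙ tail x
  ∙-head-tail f x = refl

  ∙-head-injective : (f x y : Vector ℚ (suc n)) → f zero ≢ 0ℚ →
                     tail x ≡ tail y → f ∙ x ≡ f ∙ y → x zero ≡ y zero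
  ∙-head-injective f x y f₀≢0 tx≡ty eq = *-cancelˡ-≢0 (f zero) f₀≢0
    (∙-cancelʳ (tail f ∙ tail y) (f zero * x zero) (f zero * y zero)
      (trans (cong (λ z → f zero * x zero + tail f ∙ z) (sym tx≡ty)) eq))

  LinearlyIndependent : (Fin m → Vector ℚ n) → Set
  LinearlyIndependent {m} F =
    ∀ (c : Vector ℚ m) → (∀ l → ∑[ k < m ] (c k * F k l) ≡ 0ℚ) → ∀ k → c k ≡ 0ℚ

  Solves : (Fin m → Vector ℚ n) → Vector ℚ n → Set
  Solves F x = ∀ k → F k ∙ x ≡ 0ℚ

  solves? : (F : Fin m → Vector ℚ n) → Decidable (Solves F)
  solves? F x = all? (λ k → F k ∙ x ℚ.≟ 0ℚ)

  independent-from-tail : (F : Fin (suc m) → Vector ℚ n) → LinearlyIndependent (tail F) →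
                          ¬ (∀ x → Solves (tail F) x → F zero ∙ x ≡ 0ℚ) → LinearlyIndependent F
  independent-from-tail {m} F indTail head≢0 c dep with c zero ℚ.≟ 0ℚ
  ... | yes c₀≡0 = λ { zero → c₀≡0 ; (suc k) → indTail (tail c) depTail k }
    where
    depTail : ∀ l → ∑[ k < m ] (c (suc k) * F (suc k) l) ≡ 0ℚ
    depTail l = begin
      rest                     ≡⟨ ℚ.+-identityˡ rest ⟨
      0ℚ + rest                ≡⟨ cong (_+ rest) (ℚ.*-zeroˡ (F zero l)) ⟨
      0ℚ * F zero l + rest     ≡⟨ cong (λ c₀ → c₀ * F zero l + rest) c₀≡0 ⟨
      c zero * F zero l + rest ≡⟨ dep l ⟩
      0ℚ                       ∎
      where
      open ≡-Reasoning
      rest = ∑[ k < m ] (c (suc k) * F (suc k) l)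
  ... | no c₀≢0 = contradiction (λ x sol → *-cancelˡ-≢0 (c zero) c₀≢0 (c₀*head∙x≡0 x sol)) head≢0
    where
    c₀*head∙x≡0 : ∀ x → Solves (tail F) x → c zero * (F zero ∙ x) ≡ c zero * 0ℚ
    c₀*head∙x≡0 x solTail = begin
      c zero * (F zero ∙ x)                     ≡⟨ ℚ.+-identityʳ (c zero * (F zero ∙ x)) ⟨
      c zero * (F zero ∙ x) + 0ℚ                ≡⟨ cong (c zero * (F zero ∙ x) +_) tail-terms ⟨
      ∑[ k < suc m ] (c k * (F k ∙ x))          ≡⟨ ∑-∙ c F x ⟩
      (λ l → ∑[ k < suc m ] (c k * F k l)) ∙ x  ≡⟨ ∑-zero combination-terms ⟩
      0ℚ                                        ≡⟨ ℚ.*-zeroʳ (c zero) ⟨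
      c zero * 0ℚ                               ∎
      where
      open ≡-Reasoning
      tail-terms = ∑-zero λ k → trans (cong (c (suc k) *_) (solTail k)) (ℚ.*-zeroʳ (c (suc k)))
      combination-terms = λ l → trans (cong (_* x l) (dep l)) (ℚ.*-zeroˡ (x l))

  module _ (F : Fin (suc m) → Vector ℚ n) (k₀ : Fin (suc m)) (ν : Vector ℚ m) where

    eliminate : Fin m → Vector ℚ n
    eliminate k l = F (punchIn k₀ k) l + ν k * F k₀ l

    eliminate-solves : ∀ {x} → Solves F x → Solves eliminate x
    eliminate-solves {x} sol k = begin
      eliminate k ∙ x                           ≡⟨ ∙-linearˡ (F (punchIn k₀ k)) (F k₀) x (ν k) ⟩
      F (punchIn k₀ k) ∙ x + ν k * (F k₀ ∙ x)   ≡⟨ cong₂ (λ a b → a + ν k * b) (sol (punchIn k₀ k)) (sol k₀) ⟩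
      0ℚ + ν k * 0ℚ                             ≡⟨ ℚ.+-identityˡ (ν k * 0ℚ) ⟩
      ν k * 0ℚ                                  ≡⟨ ℚ.*-zeroʳ (ν k) ⟩
      0ℚ                                        ∎
      where open ≡-Reasoning

    eliminate-independent : LinearlyIndependent F → LinearlyIndependent eliminate
    eliminate-independent indF c dep k = begin
      c k                ≡⟨ insertAt-punchIn c k₀ c₀ k ⟨
      c′ (punchIn k₀ k)  ≡⟨ indF c′ (λ l → trans (same-combination l) (dep l)) (punchIn k₀ k) ⟩
      0ℚ                 ∎
      where
      open ≡-Reasoning
      c₀ : ℚ
      c₀ = ∑[ k < m ] (c k * ν k)
      c′ : Vector ℚ (suc m)
      c′ = insertAt c k₀ c₀
      same-combination : ∀ l → ∑[ k < suc m ] (c′ k * F k l) ≡ ∑[ k < m ] (c k * eliminate k l)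
      same-combination l = begin
        ∑[ k < suc m ] (c′ k * F k l)
          ≡⟨ sum-remove {i = k₀} (λ k → c′ k * F k l) ⟩
        c′ k₀ * F k₀ l + ∑[ k < m ] (c′ (punchIn k₀ k) * F (punchIn k₀ k) l)
          ≡⟨ cong₂ _+_ (cong (_* F k₀ l) (insertAt-lookup c k₀ c₀))
                       (sum-cong-≗ λ k → cong (_* F (punchIn k₀ k) l) (insertAt-punchIn c k₀ c₀ k)) ⟩
        c₀ * F k₀ l + ∑[ k < m ] (c k * F (punchIn k₀ k) l)
          ≡⟨ cong (_+ ∑[ k < m ] (c k * F (punchIn k₀ k) l))
                  (*-distribʳ-sum (F k₀ l) (λ k → c k * ν k)) ⟩
        ∑[ k < m ] (c k * ν k * F k₀ l) + ∑[ k < m ] (c k * F (punchIn k₀ k) l)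
          ≡⟨ ∑-distrib-+ (λ k → c k * ν k * F k₀ l) (λ k → c k * F (punchIn k₀ k) l) ⟨
        ∑[ k < m ] (c k * ν k * F k₀ l + c k * F (punchIn k₀ k) l)
          ≡⟨ sum-cong-≗ (λ k → solve 4 (λ c ν p f → c :* ν :* p :+ c :* f := c :* (f :+ ν :* p)) refl
                                        (c k) (ν k) (F k₀ l) (F (punchIn k₀ k) l)) ⟩
        ∑[ k < m ] (c k * eliminate k l) ∎

  module _ (F : Fin (suc m) → Vector ℚ (suc n)) (k₀ : Fin (suc m)) (pivot≢0 : F k₀ zero ≢ 0ℚ) where

    private instance
      pivot-nonZero : ℚ.NonZero (F k₀ zero)
      pivot-nonZero = ℚ.≢-nonZero pivot≢0

    pivotMultipliers : Vector ℚ m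
    pivotMultipliers k = - (F (punchIn k₀ k) zero * 1/ F k₀ zero)

    clearPivotColumn : Fin m → Vector ℚ (suc n)
    clearPivotColumn = eliminate F k₀ pivotMultipliers

    clearPivotColumn-zero : ∀ k → clearPivotColumn k zero ≡ 0ℚ
    clearPivotColumn-zero k = begin
      a + - (a * 1/ p) * p     ≡⟨ solve 3 (λ a q p → a :+ :- (a :* q) :* p := a :+ :- (a :* (q :* p)))
                                           refl a (1/ p) p ⟩
      a + - (a * (1/ p * p))   ≡⟨ cong (λ q → a + - (a * q)) (ℚ.*-inverseˡ p) ⟩
      a + - (a * 1ℚ)           ≡⟨ cong (λ b → a + - b) (ℚ.*-identityʳ a) ⟩
      a + - a                  ≡⟨ ℚ.+-inverseʳ a ⟩
      0ℚ                       ∎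
      where
      open ≡-Reasoning
      a = F (punchIn k₀ k) zero
      p = F k₀ zero

  module _ (F : Fin m → Vector ℚ (suc n)) (zeroColumn : ∀ k → F k zero ≡ 0ℚ) where

    dropZeroColumn-independent : LinearlyIndependent F → LinearlyIndependent (tail ∘ F)
    dropZeroColumn-independent indF c dep = indF c λ where
      zero    → ∑-zero λ k → trans (cong (c k *_) (zeroColumn k)) (ℚ.*-zeroʳ (c k))
      (suc l) → dep l

    dropZeroColumn-solves : ∀ {x} → Solves F x → Solves (tail ∘ F) (tail x)
    dropZeroColumn-solves {x} sol k = begin
      tail (F k) ∙ tail x                      ≡⟨ ℚ.+-identityˡ (tail (F k) ∙ tail x) ⟨
      0ℚ + tail (F k) ∙ tail x                 ≡⟨ cong (_+ tail (F k) ∙ tail x) zero-term ⟨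
      F k zero * x zero + tail (F k) ∙ tail x  ≡⟨ ∙-head-tail (F k) x ⟨
      F k ∙ x                                  ≡⟨ sol k ⟩
      0ℚ                                       ∎
      where
      open ≡-Reasoning
      zero-term = trans (cong (_* x zero) (zeroColumn k)) (ℚ.*-zeroˡ (x zero))

  data EliminationStep {n} : ∀ {m} → (Fin m → Vector ℚ (suc n)) → Set where
    dropColumn : ∀ {m} {F : Fin m → Vector ℚ (suc n)} (G : Fin m → Vector ℚ n) →
                 LinearlyIndependent G → (∀ x → Solves F x → Solves G (tail x)) → EliminationStep F
    pivot : ∀ {m} {F : Fin (suc m) → Vector ℚ (suc n)} (G : Fin m → Vector ℚ n) →
            LinearlyIndependent G → (∀ x → Solves F x → Solves G (tail x)) →
            (∀ x y → Solves F x → Solves F y → tail x ≡ tail y → x zero ≡ y zero) → EliminationStep F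

  -- Adding multiples of the pivot row clears the first column of the other rows.
  pivotStep : (F : Fin (suc m) → Vector ℚ (suc n)) (k₀ : Fin (suc m)) → F k₀ zero ≢ 0ℚ →
              LinearlyIndependent F → EliminationStep F
  pivotStep F k₀ pivot≢0 indF = pivot (tail ∘ H)
    (dropZeroColumn-independent H H-zero (eliminate-independent F k₀ ν indF))
    (λ x → dropZeroColumn-solves H H-zero {x} ∘ eliminate-solves F k₀ ν {x})
    (λ x y solx soly tx≡ty →
      ∙-head-injective (F k₀) x y pivot≢0 tx≡ty (trans (solx k₀) (sym (soly k₀))))
    where
    ν = pivotMultipliers F k₀ pivot≢0
    H = clearPivotColumn F k₀ pivot≢0
    H-zero = clearPivotColumn-zero F k₀ pivot≢0

  eliminationStep : (F : Fin m → Vector ℚ (suc n)) → LinearlyIndependent F → EliminationStep F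
  eliminationStep {m} F indF with all? (λ k → F k zero ℚ.≟ 0ℚ)
  ... | yes zeroColumn = dropColumn (tail ∘ F) (dropZeroColumn-independent F zeroColumn indF)
                                    (λ x → dropZeroColumn-solves F zeroColumn {x})
  ... | no ¬zeroColumn with ¬∀⟶∃¬ m _ (λ k → F k zero ℚ.≟ 0ℚ) ¬zeroColumn
  eliminationStep {suc m} F indF | no _ | k₀ , pivot≢0 = pivotStep F k₀ pivot≢0 indF

  independent⇒rows≤columns : (F : Fin m → Vector ℚ n) → LinearlyIndependent F → m ≤ n
  independent⇒rows≤columns {zero}  F indF = z≤n
  independent⇒rows≤columns {suc m} {zero} F indF = contradiction (indF (λ _ → 1ℚ) (λ ()) zero) (λ ())
  independent⇒rows≤columns {suc m} {suc n} F indF with eliminationStep F indF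
  ... | dropColumn G indG _ = ℕ.m≤n⇒m≤1+n (independent⇒rows≤columns G indG)
  ... | pivot G indG _ _    = s≤s (independent⇒rows≤columns G indG)

  -- With denominator 1, ℚ's addition and multiplication compute to those of ℤ.
  toℚ≡mkℚ : ∀ z → toℚ z ≡ mkℚ z 0 (Coprime.sym (Coprime.1-coprimeTo ℤ.∣ z ∣))
  toℚ≡mkℚ (ℤ.+ n)  = ℚ.normalize-coprime (Coprime.sym (Coprime.1-coprimeTo n))
  toℚ≡mkℚ -[1+ n ] = cong -_ (ℚ.normalize-coprime (Coprime.sym (Coprime.1-coprimeTo (suc n))))

  toℚ-+ : ∀ a b → toℚ (a ℤ.+ b) ≡ toℚ a + toℚ b
  toℚ-+ a b = begin
    toℚ (a ℤ.+ b)
      ≡⟨ cong₂ (λ a′ b′ → (a′ ℤ.+ b′) ℚ./ 1) (ℤ.*-identityʳ a) (ℤ.*-identityʳ b) ⟨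
    (a ℤ.* ℤ.+ 1 ℤ.+ b ℤ.* ℤ.+ 1) ℚ./ 1
      ≡⟨ cong₂ _+_ (toℚ≡mkℚ a) (toℚ≡mkℚ b) ⟨
    toℚ a + toℚ b ∎
    where open ≡-Reasoning

  toℚ-* : ∀ a b → toℚ (a ℤ.* b) ≡ toℚ a * toℚ b
  toℚ-* a b = sym (cong₂ _*_ (toℚ≡mkℚ a) (toℚ≡mkℚ b))

  toℚ-injective : ∀ {a b} → toℚ a ≡ toℚ b → a ≡ b
  toℚ-injective {a} {b} eq = cong ℚ.numerator (trans (sym (toℚ≡mkℚ a)) (trans eq (toℚ≡mkℚ b)))

  toℚ-Σℤ : ∀ n (f : Fin n → ℤ) → toℚ (Σℤ n f) ≡ ∑[ k < n ] toℚ (f k)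
  toℚ-Σℤ zero    f = refl
  toℚ-Σℤ (suc n) f =
    trans (toℚ-+ (f zero) (Σℤ n (f ∘ suc))) (cong (toℚ (f zero) +_) (toℚ-Σℤ n (f ∘ suc)))

open LinearSystems

module PointCounting where

  open import Data.Integer as ℤ using (ℤ)
  import Data.Integer.Properties as ℤ
  open import Algebra.Properties.CommutativeSemigroup ℕ.+-commutativeSemigroup using (x∙yz≈y∙xz)
  import Algebra.Properties.AbelianGroup ℤ.+-0-abelianGroup as ℤ+
  open import Data.List as List using (List; []; _∷_; map; concatMap; filter; length)
  open import Data.List.Properties
    using (length-filter; filter-++; length-++; filter-none; length-map; length-upTo)
  import Data.List.Relation.Unary.All as All
  open import Data.List.Relation.Unary.AllPairs using ([]; _∷_)
  open import Data.List.Relation.Unary.Unique.Propositional using (Unique)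
  import Data.List.Relation.Unary.Unique.Propositional.Properties as Unique
  open import Data.List.Relation.Binary.Sublist.Propositional using (⊆-refl)
  open import Data.List.Relation.Binary.Sublist.Heterogeneous.Properties using (length-mono-≤; ⊆-filter-Sublist)
  open import Data.Nat using (_+_; _*_; _^_; _∸_)
  open import Data.Nat.ListAction using (sum)
  open import Data.Rational using (ℚ)
  open import Data.Vec as Vec using (Vec; lookup)

  module _ {A : Set} {P Q : A → Set} (P? : Decidable P) (Q? : Decidable Q) where

    length-filter-mono : (∀ {x} → P x → Q x) → ∀ xs → length (filter P? xs) ≤ length (filter Q? xs)
    length-filter-mono P⇒Q xs = length-mono-≤ (⊆-filter-Sublist P? Q? (λ { refl → P⇒Q }) (⊆-refl {x = xs}))

  module _ {A : Set} {P : A → Set} (P? : Decidable P) where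

    length-filter-≤1 : (∀ {x y} → P x → P y → x ≡ y) → ∀ {xs} → Unique xs → length (filter P? xs) ≤ 1
    length-filter-≤1 P-unique {[]}     []              = z≤n
    length-filter-≤1 P-unique {x ∷ xs} (x∉xs ∷ unique) with P? x
    ... | no  _  = length-filter-≤1 P-unique unique
    ... | yes Px = s≤s (ℕ.≤-reflexive (cong length (filter-none P? none)))
      where none = All.map (λ x≢y Py → x≢y (P-unique Px Py)) x∉xs

    length-filter-map : ∀ {B : Set} (f : B → A) xs →
                        length (filter P? (map f xs)) ≡ length (filter (P? ∘ f) xs)
    length-filter-map f []       = refl
    length-filter-map f (x ∷ xs) with P? (f x)
    ... | yes _ = cong suc (length-filter-map f xs)
    ... | no  _ = length-filter-map f xs

    length-filter-concatMap-map : ∀ {B C : Set} (g : B → C → A) xs ys →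
      length (filter P? (concatMap (λ b → map (g b) ys) xs)) ≡ sum (map (λ b → length (filter (P? ∘ g b) ys)) xs)
    length-filter-concatMap-map g []       ys = refl
    length-filter-concatMap-map g (x ∷ xs) ys = begin
      length (filter P? (map (g x) ys List.++ rest))
        ≡⟨ cong length (filter-++ P? (map (g x) ys) rest) ⟩
      length (filter P? (map (g x) ys) List.++ filter P? rest)
        ≡⟨ length-++ (filter P? (map (g x) ys)) ⟩
      length (filter P? (map (g x) ys)) + length (filter P? rest)
        ≡⟨ cong₂ _+_ (length-filter-map (g x) ys) (length-filter-concatMap-map g xs ys) ⟩
      sum (map (λ b → length (filter (P? ∘ g b) ys)) (x ∷ xs)) ∎
      where
      open ≡-Reasoning
      rest = concatMap (λ b → map (g b) ys) xs

  sum-map-≤ : ∀ {A : Set} {f : A → ℕ} {b} → (∀ x → f x ≤ b) → ∀ xs → sum (map f xs) ≤ length xs * b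
  sum-map-≤ f≤b []       = z≤n
  sum-map-≤ f≤b (x ∷ xs) = ℕ.+-mono-≤ (f≤b x) (sum-map-≤ f≤b xs)

  module _ {A B : Set} {P : A → B → Set} {Q : B → Set} (P? : ∀ a → Decidable (P a)) (Q? : Decidable Q) where

    private
      #P : List B → A → ℕ
      #P ys a = length (filter (P? a) ys)

      #Pᵀ : List A → B → ℕ
      #Pᵀ xs b = length (filter (λ a → P? a b) xs)

      exchange : ∀ p n t {s} → s ≡ n + t → p + s ≡ n + (p + t)
      exchange p n t s≡n+t = trans (cong (p +_) s≡n+t) (x∙yz≈y∙xz p n t)

    sum-length-filter-∷ : ∀ xs b ys → sum (map (#P (b ∷ ys)) xs) ≡ #Pᵀ xs b + sum (map (#P ys) xs)
    sum-length-filter-∷ []       b ys = refl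
    sum-length-filter-∷ (a ∷ xs) b ys with P? a b
    ... | yes _ = cong suc (exchange (#P ys a) (#Pᵀ xs b) (sum (map (#P ys) xs)) (sum-length-filter-∷ xs b ys))
    ... | no  _ = exchange (#P ys a) (#Pᵀ xs b) (sum (map (#P ys) xs)) (sum-length-filter-∷ xs b ys)

    -- Double counting: each b is hit by at most one a, and only when Q b holds.
    sum-length-filter-≤ : ∀ xs → (∀ {a b} → P a b → Q b) → (∀ b → #Pᵀ xs b ≤ 1) →
                          ∀ ys → sum (map (#P ys) xs) ≤ length (filter Q? ys)
    sum-length-filter-≤ xs P⇒Q atMostOne [] =
      ℕ.≤-trans (sum-map-≤ (λ _ → z≤n) xs) (ℕ.≤-reflexive (ℕ.*-zeroʳ (length xs)))
    sum-length-filter-≤ xs P⇒Q atMostOne (b ∷ ys) with Q? b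
    ... | yes _ = begin
      sum (map (#P (b ∷ ys)) xs)       ≡⟨ sum-length-filter-∷ xs b ys ⟩
      #Pᵀ xs b + sum (map (#P ys) xs)  ≤⟨ ℕ.+-mono-≤ (atMostOne b) (sum-length-filter-≤ xs P⇒Q atMostOne ys) ⟩
      suc (length (filter Q? ys))      ∎
      where open ℕ.≤-Reasoning
    ... | no ¬Qb = begin
      sum (map (#P (b ∷ ys)) xs)       ≡⟨ sum-length-filter-∷ xs b ys ⟩
      #Pᵀ xs b + sum (map (#P ys) xs)  ≡⟨ cong (λ zs → length zs + sum (map (#P ys) xs)) none ⟩
      sum (map (#P ys) xs)             ≤⟨ sum-length-filter-≤ xs P⇒Q atMostOne ys ⟩
      length (filter Q? ys)            ∎
      where
      open ℕ.≤-Reasoning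
      none = filter-none (λ a → P? a b) (All.universal (λ a Pab → ¬Qb (P⇒Q Pab)) xs)

  range-length : ∀ N → length (range N) ≡ suc (2 * N)
  range-length N = trans (length-map _ (List.upTo (suc (2 * N)))) (length-upTo (suc (2 * N)))

  range-unique : ∀ N → Unique (range N)
  range-unique N = Unique.map⁺ shift-injective (Unique.upTo⁺ (suc (2 * N)))
    where
    shift-injective : ∀ {a b} → ℤ.+ a ℤ.- ℤ.+ N ≡ ℤ.+ b ℤ.- ℤ.+ N → a ≡ b
    shift-injective eq = ℤ.+-injective (ℤ+.∙-cancelʳ (ℤ.- ℤ.+ N) (ℤ.+ _) (ℤ.+ _) eq)

  vecToℚ : Vec ℤ n → Vector ℚ n
  vecToℚ y l = toℚ (lookup y l)

  solutionCount : ℕ → (Fin m → Vector ℚ n) → ℕ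
  solutionCount {n = n} N F = length (filter (solves? F ∘ vecToℚ) (box N n))

  solutionCount-byFirstCoordinate : ∀ N (F : Fin m → Vector ℚ (suc n)) →
    solutionCount N F ≡ sum (map (λ a → length (filter (solves? F ∘ vecToℚ ∘ (a Vec.∷_)) (box N n))) (range N))
  solutionCount-byFirstCoordinate {n = n} N F =
    length-filter-concatMap-map (solves? F ∘ vecToℚ) Vec._∷_ (range N) (box N n)

  solutionCount-≤ : ∀ N (F : Fin m → Vector ℚ n) → LinearlyIndependent F →
                    solutionCount N F ≤ suc (2 * N) ^ (n ∸ m)
  solutionCount-≤ {m} {zero} N F indF = begin
    solutionCount N F      ≤⟨ length-filter (solves? F ∘ vecToℚ) (box N 0) ⟩
    1                      ≡⟨ cong (suc (2 * N) ^_) (ℕ.0∸n≡0 m) ⟨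
    suc (2 * N) ^ (0 ∸ m)  ∎
    where open ℕ.≤-Reasoning
  solutionCount-≤ {m} {suc n} N F indF with eliminationStep F indF
  ... | dropColumn G indG solves = begin
    solutionCount N F
      ≡⟨ solutionCount-byFirstCoordinate N F ⟩
    sum (map (λ a → length (filter (solves? F ∘ vecToℚ ∘ (a Vec.∷_)) (box N n))) (range N))
      ≤⟨ sum-map-≤ fibre-≤ (range N) ⟩
    length (range N) * W ^ (n ∸ m)
      ≡⟨ cong (_* W ^ (n ∸ m)) (range-length N) ⟩
    W ^ suc (n ∸ m)
      ≡⟨ cong (W ^_) (ℕ.+-∸-assoc 1 (independent⇒rows≤columns G indG)) ⟨
    W ^ (suc n ∸ m) ∎
    where
    open ℕ.≤-Reasoning
    W = suc (2 * N)
    fibre-≤ : ∀ a → length (filter (solves? F ∘ vecToℚ ∘ (a Vec.∷_)) (box N n)) ≤ W ^ (n ∸ m)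
    fibre-≤ a = ℕ.≤-trans
      (length-filter-mono _ (solves? G ∘ vecToℚ) (λ {y} → solves (vecToℚ (a Vec.∷ y))) (box N n))
      (solutionCount-≤ N G indG)
  ... | pivot G indG solves unique = ℕ.≤-trans (begin
    solutionCount N F
      ≡⟨ solutionCount-byFirstCoordinate N F ⟩
    sum (map (λ a → length (filter (solves? F ∘ vecToℚ ∘ (a Vec.∷_)) (box N n))) (range N))
      ≤⟨ sum-length-filter-≤ (λ a → solves? F ∘ vecToℚ ∘ (a Vec.∷_)) (solves? G ∘ vecToℚ) (range N)
                             (λ {a} {y} → solves (vecToℚ (a Vec.∷ y))) atMostOne (box N n) ⟩
    solutionCount N G ∎) (solutionCount-≤ N G indG)
    where
    open ℕ.≤-Reasoning
    atMostOne : ∀ y → length (filter (λ a → solves? F (vecToℚ (a Vec.∷ y))) (range N)) ≤ 1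
    atMostOne y = length-filter-≤1 (λ a → solves? F (vecToℚ (a Vec.∷ y)))
      (λ {a} {b} sa sb → toℚ-injective (unique (vecToℚ (a Vec.∷ y)) (vecToℚ (b Vec.∷ y)) sa sb refl))
      (range-unique N)

open PointCounting

module EqualityConstraint {r t : ℕ} (V : Matℤ r t) (i j : Fin t) where

  open import Data.Integer as ℤ using ()
  open import Data.Rational as ℚ using (ℚ; 0ℚ; 1ℚ; _+_; _*_; -_; _-_)
  import Data.Rational.Properties as ℚ
  open import Data.Vec using (lookup)
  open import Algebra.Bundles using (CommutativeRing)
  open import Algebra.Properties.Group ℚ.+-0-group using (x∙y⁻¹≈ε⇒x≈y; x≈y⇒x∙y⁻¹≈ε)
  open import Algebra.Properties.Ring ℚ.+-*-ring using (-1*x≈-x)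
  open import Algebra.Properties.Semiring.Sum (CommutativeRing.semiring ℚ.+-*-commutativeRing)
    using (sum-syntax; sum-cong-≗)

  system : Fin (suc r) → Vector ℚ t
  system zero    l = δ i l + - 1ℚ * δ j l
  system (suc k) l = toℚ (V k l)

  system-head-∙ : ∀ x → system zero ∙ x ≡ x i - x j
  system-head-∙ x = begin
    system zero ∙ x              ≡⟨ ∙-linearˡ (δ i) (δ j) x (- 1ℚ) ⟩
    δ i ∙ x + - 1ℚ * (δ j ∙ x)   ≡⟨ cong₂ (λ a b → a + - 1ℚ * b) (∑-δ i x) (∑-δ j x) ⟩
    x i + - 1ℚ * x j             ≡⟨ cong (x i +_) (-1*x≈-x (x j)) ⟩
    x i - x j                    ∎
    where open ≡-Reasoning

  inKer⇒solves : ∀ {x} → InKer V x → Solves (tail system) x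
  inKer⇒solves {x} inKer k = trans (sym (Σℚ≡∑ t (λ l → toℚ (V k l) * x l))) (inKer k)

  hasRankRows⇒independent : HasRankRows V → LinearlyIndependent (tail system)
  hasRankRows⇒independent rank c dep =
    rank c (λ l → trans (Σℚ≡∑ r (λ k → c k * toℚ (V k l))) (dep l))

  apply-δ : ∀ {d} (ψ : Fin t → Fin d → ℚ) (l : Fin d) (j′ : Fin t) → apply ψ (δ l) j′ ≡ ψ j′ l
  apply-δ {d} ψ l j′ = begin
    Σℚ d (λ l′ → ψ j′ l′ * δ l l′)    ≡⟨ Σℚ≡∑ d (λ l′ → ψ j′ l′ * δ l l′) ⟩
    ∑[ l′ < d ] (ψ j′ l′ * δ l l′)    ≡⟨ sum-cong-≗ (λ l′ → ℚ.*-comm (ψ j′ l′) (δ l l′)) ⟩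
    ∑[ l′ < d ] (δ l l′ * ψ j′ l′)    ≡⟨ ∑-δ l (ψ j′) ⟩
    ψ j′ l                            ∎
    where open ≡-Reasoning

  -- x i = x j on the kernel forces ψ i = ψ j, putting ψ i in the span of the block containing j.
  finiteComplexity⇒separates : FiniteComplexity V → i ≢ j → ¬ (∀ x → InKer V x → x i ≡ x j)
  finiteComplexity⇒separates (d , ψ , (ψ-inKer , _) , finite) i≢j kernel-equal
    with finite i
  ... | _ , block , _ , ψᵢ∉span = ψᵢ∉span (block j j≢i) (δ j , outside , spans)
    where
    j≢i = i≢j ∘ sym
    ψᵢ≗ψⱼ : ∀ l → ψ i l ≡ ψ j l
    ψᵢ≗ψⱼ l = trans (sym (apply-δ ψ l i)) (trans (kernel-equal _ (ψ-inKer (δ l))) (apply-δ ψ l j))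
    outside : ∀ j′ → ¬ (Σ (j′ ≢ i) λ p → block j′ p ≡ block j j≢i) → δ j j′ ≡ 0ℚ
    outside j′ j′∉block with j Fin.≟ j′
    ... | yes refl = contradiction (j≢i , refl) j′∉block
    ... | no  _    = refl
    spans : ∀ l → Σℚ t (λ j′ → δ j j′ * ψ j′ l) ≡ ψ i l
    spans l = trans (Σℚ≡∑ t (λ j′ → δ j j′ * ψ j′ l))
                    (trans (∑-δ j (λ j′ → ψ j′ l)) (sym (ψᵢ≗ψⱼ l)))

  system-independent : HasRankRows V → FiniteComplexity V → i ≢ j → LinearlyIndependent system
  system-independent rank finite i≢j =
    independent-from-tail system (hasRankRows⇒independent rank) λ head-vanishes →
      finiteComplexity⇒separates finite i≢j λ x inKer →
        x∙y⁻¹≈ε⇒x≈y (x i) (x j) (trans (sym (system-head-∙ x)) (head-vanishes x (inKer⇒solves inKer)))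

  pred⇒solves : ∀ {y} → Pred V i j y → Solves system (vecToℚ y)
  pred⇒solves {y} (_ , yᵢ≡yⱼ) zero = trans (system-head-∙ (vecToℚ y)) (x≈y⇒x∙y⁻¹≈ε (cong toℚ yᵢ≡yⱼ))
  pred⇒solves {y} (Vy≡0 , _) (suc k) = begin
    ∑[ l < t ] (toℚ (V k l) * toℚ (lookup y l))  ≡⟨ sum-cong-≗ (λ l → toℚ-* (V k l) (lookup y l)) ⟨
    ∑[ l < t ] toℚ (V k l ℤ.* lookup y l)       ≡⟨ toℚ-Σℤ t (λ l → V k l ℤ.* lookup y l) ⟨
    toℚ (Σℤ t (λ l → V k l ℤ.* lookup y l))      ≡⟨ cong toℚ (Vy≡0 k) ⟩
    0ℚ                                           ∎
    where open ≡-Reasoning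

open import Data.Nat using (_*_; _^_; _∸_)

^-distrib-* : ∀ a b e → (a * b) ^ e ≡ a ^ e * b ^ e
^-distrib-* a b zero    = refl
^-distrib-* a b (suc e) =
  trans (cong (a * b *_) (^-distrib-* a b e)) (ℕ.[m*n]*[o*p]≡[m*o]*[n*p] a b (a ^ e) (b ^ e))

lemma4p10 : (r t : ℕ) (V : Matℤ r t) → HasRankRows V → FiniteComplexity V →
    (i j : Fin t) → i ≢ j →
    ∃ λ (C : ℕ) → ∀ (N : ℕ) → 1 ≤ N → count V i j N ≤ C * N ^ (t ∸ r ∸ 1)
lemma4p10 r t V rank finite i j i≢j = 3 ^ e , λ N 1≤N → begin
  count V i j N
    ≤⟨ length-filter-mono (Pred? V i j) (solves? system ∘ vecToℚ) (λ {y} → pred⇒solves {y}) (box N t) ⟩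
  solutionCount N system
    ≤⟨ solutionCount-≤ N system (system-independent rank finite i≢j) ⟩
  suc (2 * N) ^ (t ∸ suc r)
    ≡⟨ cong (suc (2 * N) ^_) (trans (ℕ.∸-+-assoc t r 1) (cong (t ∸_) (ℕ.+-comm r 1))) ⟨
  suc (2 * N) ^ e
    ≤⟨ ℕ.^-monoˡ-≤ e (ℕ.+-monoˡ-≤ (2 * N) 1≤N) ⟩
  (3 * N) ^ e
    ≡⟨ ^-distrib-* 3 N e ⟩
  3 ^ e * N ^ e ∎
  where
  open EqualityConstraint V i j
  open ℕ.≤-Reasoning
  e = t ∸ r ∸ 1
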